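{- Let $T$ be an $r$-vertex $K_t$-tree with a witness $(K^{(1)},j_2,K^{(2)},\dots,j_b,K^{(b)})$ of glue size at most $s$, and for $1\le k\le s$ let $d_k$ be the number of indices $2\le i\le b$ with $|V(K^{(i)})\cap V(K^{(j_i)})|=k$. Let $\ell$ be a positive integer and $\vec B=(B_1,\dots,B_s)$. Then the number of copies of this witness in any $(t,s,\ell,r,\vec B)$-strong-builder $\mathcal{G}$ is at least \[|\mathcal{G}_t|\prod_{k=1}^s B_k^{d_k}.\]
   Context: A graph $T$ is a $K_t$-tree if there is a sequence of subgraphs $K^{(1)},\dots,K^{(b)}$ of $T$, each isomorphic to $K_t$, with $V(T)=\bigcup_i V(K^{(i)})$, such that for every $2\le i\le b$ there is $j_i<i$ with (1) $V(K^{(i)})\cap(V(K^{(1)})\cup\dots\cup V(K^{(i-1)}))=V(K^{(i)})\cap V(K^{(j_i)})$ and (2) $V(K^{(i)})\cap V(K^{(j_i)})$ is neither empty nor all of $V(K^{(i)})$. The sequence $(K^{(1)},j_2,K^{(2)},\dots,j_b,K^{(b)})$ is a witness; its glue size is the largest value of $|V(K^{(i)})\cap V(K^{(j_i)})|$ over $2\le i\le b$. A copy of the witness in a $t$-complex $\mathcal{G}$ is a sequence $(L^{(1)},\dots,L^{(b)})$ of sets in $\mathcal{G}$ together with a bijection $V(T)\to L^{(1)}\cup\dots\cup L^{(b)}$ mapping $V(K^{(i)})$ onto $L^{(i)}$ for each $i$. A $t$-complex $\mathcal{G}$ is a collection of nonempty sets of size at most $t$ closed under nonempty subsets; $\mathcal{G}_i$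 = members of size $i$; $V(\mathcal{G})$ = union of members; $\deg_{\mathcal{G}}(K)$ = number of members of $\mathcal{G}_t$ containing $K$; $\mathcal{G}\setminus S=\{K\setminus S:K\in\mathcal{G},K\not\subseteq S\}$. $\mathcal{G}$ is a $(t,s,\ell,\vec B)$-weak-builder ($s<t$) if every $K\in\mathcal{G}_i$, $1\le i\le s$, has $\deg_{\mathcal{G}}(K)\ge B_i$ and every $K\in\mathcal{G}_{s+1}$ has $\deg_{\mathcal{G}}(K)\le\ell$; it is a $(t,s,\ell,r,\vec B)$-strong-builder if $\mathcal{G}\setminus S$ is a $(t,s,\ell,\vec B)$-weak-builder for every $S\subseteq V(\mathcal{G})$ with $|S|\le r$. -}

module Defs where

open import Data.Bool using (Bool; true; false; _∧_; _∨_; not; T)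
open import Data.Nat using (ℕ; zero; suc; _+_; _*_; _^_; _≤_; _<_; _≡ᵇ_; _<ᵇ_; _≤ᵇ_)
open import Data.Fin using (Fin; toℕ)
import Data.Fin as F
open import Data.Fin.Subset using (Subset; _∈_; _⊆_; _∩_; _∪_; _─_; ∣_∣; Nonempty; ⊥)
open import Data.Vec using (Vec; []; _∷_; lookup; tabulate)
open import Data.Vec.Properties using (≡-dec)
import Data.Bool.Properties as BoolP
open import Data.List using (List; []; _∷_; _++_; map; concatMap)
open import Data.Product using (_×_; Σ; ∃; _,_; proj₁; proj₂)
open import Relation.Binary.PropositionalEquality using (_≡_; _≢_)
open import Relation.Nullary.Decidable using (⌊_⌋)

anyFin : (n : ℕ) → (Fin n → Bool) → Bool
anyFin zero    p = false
anyFin (suc n) p = p F.zero ∨ anyFin n (λ i → p (F.suc i))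

allFin : (n : ℕ) → (Fin n → Bool) → Bool
allFin zero    p = true
allFin (suc n) p = p F.zero ∧ allFin n (λ i → p (F.suc i))

countFin : (n : ℕ) → (Fin n → Bool) → ℕ
countFin zero    p = 0
countFin (suc n) p = (if p F.zero then 1 else 0) + countFin n (λ i → p (F.suc i))
  where
  if_then_else_ : Bool → ℕ → ℕ → ℕ
  if true  then a else b = a
  if false then a else b = b

prodFin : (n : ℕ) → (Fin n → ℕ) → ℕ
prodFin zero    f = 1
prodFin (suc n) f = f F.zero * prodFin n (λ i → f (F.suc i))

countList : {A : Set} → (A → Bool) → List A → ℕ
countList p []       = 0
countList p (x ∷ xs) with p x
... | true  = suc (countList p xs)
... | false = countList p xs

anyList : {A : Set} → (A → Bool) → List A → Bool
anyList p []       = false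
anyList p (x ∷ xs) = p x ∨ anyList p xs

allSubsets : (n : ℕ) → List (Subset n)
allSubsets zero    = [] ∷ []
allSubsets (suc n) = map (true ∷_) (allSubsets n) ++ map (false ∷_) (allSubsets n)

allVecs : {A : Set} → List A → (k : ℕ) → List (Vec A k)
allVecs xs zero    = [] ∷ []
allVecs xs (suc k) = concatMap (λ x → map (x ∷_) (allVecs xs k)) xs

allFins : (n : ℕ) → List (Fin n)
allFins zero    = []
allFins (suc n) = F.zero ∷ map F.suc (allFins n)

eqSᵇ : {n : ℕ} → Subset n → Subset n → Bool
eqSᵇ A B = ⌊ ≡-dec BoolP._≟_ A B ⌋

subᵇ : {n : ℕ} → Subset n → Subset n → Bool
subᵇ {n} A B = allFin n (λ x → not (lookup A x) ∨ lookup B x)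

eqFᵇ : {n : ℕ} → Fin n → Fin n → Bool
eqFᵇ x y = ⌊ x F.≟ y ⌋

image : {r n : ℕ} → Vec (Fin n) r → Subset r → Subset n
image {r} φ A = tabulate (λ y → anyFin r (λ x → lookup A x ∧ eqFᵇ (lookup φ x) y))

injᵇ : {r n : ℕ} → Vec (Fin n) r → Bool
injᵇ {r} φ = allFin r (λ x → allFin r (λ y → not (eqFᵇ (lookup φ x) (lookup φ y)) ∨ eqFᵇ x y))

bigUnion : {n b : ℕ} → Vec (Subset n) b → Subset n
bigUnion []       = ⊥
bigUnion (L ∷ Ls) = L ∪ bigUnion Ls

-- Complexes on the ground set Fin n; a complex is given by its
-- (decidable) membership predicate G : Subset n → Bool.

IsTComplex : {n : ℕ} → ℕ → (Subset n → Bool) → Set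
IsTComplex t G =
  ∀ A → T (G A) →
    (Nonempty A × ∣ A ∣ ≤ t) × (∀ C → C ⊆ A → Nonempty C → T (G C))

InVertexSet : {n : ℕ} → (Subset n → Bool) → Subset n → Set
InVertexSet G S = ∀ {x} → x ∈ S → ∃ λ K → T (G K) × x ∈ K

layer : {n : ℕ} → (Subset n → Bool) → ℕ → Subset n → Bool
layer G i A = G A ∧ (∣ A ∣ ≡ᵇ i)

layerSize : {n : ℕ} → (Subset n → Bool) → ℕ → ℕ
layerSize {n} G t = countList (layer G t) (allSubsets n)

deg : {n : ℕ} → ℕ → (Subset n → Bool) → Subset n → ℕ
deg {n} t G K = countList (λ A → layer G t A ∧ subᵇ K A) (allSubsets n)

minus : {n : ℕ} → (Subset n → Bool) → Subset n → Subset n → Bool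
minus {n} G S A =
  anyList (λ K → G K ∧ not (subᵇ K S) ∧ eqSᵇ (K ─ S) A) (allSubsets n)

-- (t,s,ℓ,B)-weak-builder; B k stands for B_{k+1}, k : Fin s
IsWeakBuilder : {n : ℕ} (t s ℓ : ℕ) → (Fin s → ℕ) → (Subset n → Bool) → Set
IsWeakBuilder t s ℓ B G =
  (∀ K → T (G K) → (i : Fin s) → ∣ K ∣ ≡ suc (toℕ i) → B i ≤ deg t G K) ×
  (∀ K → T (G K) → ∣ K ∣ ≡ suc s → deg t G K ≤ ℓ)

IsStrongBuilder : {n : ℕ} (t s ℓ r : ℕ) → (Fin s → ℕ) → (Subset n → Bool) → Set
IsStrongBuilder t s ℓ r B G =
  ∀ S → InVertexSet G S → ∣ S ∣ ≤ r → IsWeakBuilder t s ℓ B (minus G S)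

IsSimpleGraph : {r : ℕ} → (Fin r → Fin r → Set) → Set
IsSimpleGraph E = (∀ x y → E x y → E y x) × (∀ x → E x x → Data.Empty.⊥)
  where import Data.Empty

-- union of K m over m < i   (i.e. V(K^(1)) ∪ … ∪ V(K^(i-1)) in 1-based terms)
prefixUnion : {r b : ℕ} → (Fin b → Subset r) → Fin b → Subset r
prefixUnion {r} {b} K i = tabulate (λ x → anyFin b (λ m → (toℕ m <ᵇ toℕ i) ∧ lookup (K m) x))

glue : {r b : ℕ} → (Fin b → Subset r) → (Fin b → Fin b) → Fin b → Subset r
glue K j i = K i ∩ K (j i)

-- (K, j) is a witness that the graph E on Fin r is a K_t-tree.
-- 0-based indexing: K^(i+1) = K i; j is only relevant for i ≥ 1.
IsWitness : {r : ℕ} (t : ℕ) (E : Fin r → Fin r → Set) (b : ℕ)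
            → (Fin b → Subset r) → (Fin b → Fin b) → Set
IsWitness {r} t E b K j =
  1 ≤ b ×
  (∀ i → ∣ K i ∣ ≡ t) ×
  (∀ i x y → x ∈ K i → y ∈ K i → x ≢ y → E x y) ×
  (∀ (x : Fin r) → ∃ λ i → x ∈ K i) ×
  (∀ i → 1 ≤ toℕ i →
      toℕ (j i) < toℕ i ×
      K i ∩ prefixUnion K i ≡ glue K j i ×
      Nonempty (glue K j i) ×
      glue K j i ≢ K i)

GlueAtMost : {r b : ℕ} → (Fin b → Subset r) → (Fin b → Fin b) → ℕ → Set
GlueAtMost K j s = ∀ i → 1 ≤ toℕ i → ∣ glue K j i ∣ ≤ s

dcount : {r b : ℕ} → (Fin b → Subset r) → (Fin b → Fin b) → ℕ → ℕ
dcount {r} {b} K j k = countFin b (λ i → (1 ≤ᵇ toℕ i) ∧ (∣ glue K j i ∣ ≡ᵇ k))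

-- A copy of the witness in G: a sequence L of members of G together with a
-- bijection φ : Fin r → ⋃ L (injective φ with image ⋃ L) mapping K i onto L i.
isCopyᵇ : {n r b : ℕ} → (Subset n → Bool) → (Fin b → Subset r)
          → Vec (Subset n) b → Vec (Fin n) r → Bool
isCopyᵇ {n} {r} {b} G K L φ =
  allFin b (λ i → G (lookup L i) ∧ eqSᵇ (image φ (K i)) (lookup L i)) ∧
  injᵇ φ ∧
  eqSᵇ (image φ Data.Fin.Subset.⊤) (bigUnion L)
  where import Data.Fin.Subset

copies : {n r b : ℕ} → (Subset n → Bool) → (Fin b → Subset r) → ℕ
copies {n} {r} {b} G K =
  countList (λ p → isCopyᵇ G K (proj₁ p) (proj₂ p))
    (concatMap (λ L → map (L ,_) (allVecs (allFins n) r)) (allVecs (allSubsets n) b))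

module Submission where

-- Copies are built greedily, one set of the witness at a time. K⁽¹⁾ may go to any member
-- of 𝒢_t. When K⁽ⁱ⁾ is added, its glue with the earlier sets is already mapped onto a set
-- A of size k = |V(K⁽ⁱ⁾) ∩ V(K⁽ʲⁱ⁾)| ≤ s, and A ∈ 𝒢 as a subset of the image of K⁽ʲⁱ⁾.
-- Deleting the at most r vertices S used so far outside A leaves the weak builder 𝒢 ∖ S,
-- in which A has degree at least B_k. A t-set of 𝒢 ∖ S cannot have lost a vertex, so it
-- lies in 𝒢, avoids S, meets the earlier image exactly in A, and extends the partial copy
-- bijectively on the new vertices. Different choices give different sequences of sets,
-- so the numbers of choices multiply to |𝒢_t| ∏ B_k^{d_k}.

open import Defs
open import Data.Nat using (ℕ; zero; suc; _+_; _*_; _^_; _≤_; _<_; _≡ᵇ_; _<ᵇ_; _≤ᵇ_; z≤n; s≤s)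
import Data.Nat.Properties as ℕₚ
open import Data.Fin using (Fin; toℕ; fromℕ<)
import Data.Fin as F
import Data.Fin.Properties as Finₚ
open import Data.Fin.Subset using (Subset; _∈_; _∉_; _⊆_; _∩_; _─_; _-_; ∣_∣; Nonempty; Empty; ⊥; ⊤; ⁅_⁆; inside; outside)
open import Data.Fin.Subset.Properties
open import Data.Vec using (Vec; []; _∷_; lookup; replicate; _[_]≔_)
  renaming (here to hereᵛ; there to thereᵛ)
import Data.Vec.Properties as Vecₚ
open import Data.Bool using (Bool; true; false; _∧_; _∨_; not; T)
import Data.Bool.Properties as Boolₚ
open import Data.List using (List; []; _∷_; map; concatMap; length; filter)
import Data.List.Properties as Listₚ
open import Data.List.Membership.Propositional using (lose) renaming (_∈_ to _∈ˡ_)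
import Data.List.Membership.Propositional.Properties as ∈ˡₚ
open import Data.List.Relation.Unary.Any using (here; there)
open import Data.List.Relation.Unary.All as All using ([])
import Data.List.Relation.Unary.All.Properties as Allₚ
open import Data.List.Relation.Unary.AllPairs as AllPairs using (AllPairs; []; _∷_)
import Data.List.Relation.Unary.AllPairs.Properties as AllPairsₚ
open import Data.List.Relation.Unary.Unique.Propositional using (Unique)
import Data.List.Relation.Unary.Unique.Propositional.Properties as Uniqueₚ
open import Data.Product using (_×_; Σ; ∃; _,_; proj₁; proj₂)
open import Data.Sum using (_⊎_; inj₁; inj₂)
open import Data.Empty using (⊥-elim)
open import Data.Unit using (tt)
open import Function using (_∘_; Equivalence)
open import Relation.Binary.PropositionalEquality
open import Relation.Nullary using (¬_; yes; no)
open import Relation.Nullary.Decidable using (toWitness; fromWitness; T?)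

T-∧⁺ : ∀ {a b} → T a → T b → T (a ∧ b)
T-∧⁺ x y = Equivalence.from Boolₚ.T-∧ (x , y)

T-∧⁻ : ∀ {a b} → T (a ∧ b) → T a × T b
T-∧⁻ = Equivalence.to Boolₚ.T-∧

T-not⁺ : ∀ {a} → ¬ T a → T (not a)
T-not⁺ {true}  ¬a = ¬a tt
T-not⁺ {false} _  = tt

∈⇒T : ∀ {n} {x : Fin n} {p : Subset n} → x ∈ p → T (lookup p x)
∈⇒T {p = p} x∈p rewrite Vecₚ.[]=⇒lookup x∈p = tt

T⇒∈ : ∀ {n} {x : Fin n} {p : Subset n} → T (lookup p x) → x ∈ p
T⇒∈ {x = x} {p} h = Vecₚ.lookup⇒[]= x p (Equivalence.to Boolₚ.T-≡ h)

anyFin⁺ : ∀ n (p : Fin n → Bool) i → T (p i) → T (anyFin n p)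
anyFin⁺ (suc n) p F.zero    pi with p F.zero
... | true = tt
anyFin⁺ (suc n) p (F.suc i) pi with p F.zero
... | true  = tt
... | false = anyFin⁺ n (p ∘ F.suc) i pi

anyFin⁻ : ∀ n (p : Fin n → Bool) → T (anyFin n p) → ∃ λ i → T (p i)
anyFin⁻ (suc n) p h with p F.zero in eq
... | true  = F.zero , subst T (sym eq) tt
... | false = let i , pi = anyFin⁻ n (p ∘ F.suc) h in F.suc i , pi

allFin⁺ : ∀ n (p : Fin n → Bool) → (∀ i → T (p i)) → T (allFin n p)
allFin⁺ zero    p h = tt
allFin⁺ (suc n) p h = T-∧⁺ (h F.zero) (allFin⁺ n (p ∘ F.suc) (h ∘ F.suc))

allFin⁻ : ∀ n (p : Fin n → Bool) → T (allFin n p) → ∀ i → T (p i)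
allFin⁻ (suc n) p h F.zero    = proj₁ (T-∧⁻ h)
allFin⁻ (suc n) p h (F.suc i) = allFin⁻ n (p ∘ F.suc) (proj₂ (T-∧⁻ {p F.zero} h)) i

anyList⁺ : ∀ {A : Set} (p : A → Bool) {x xs} → x ∈ˡ xs → T (p x) → T (anyList p xs)
anyList⁺ p {xs = y ∷ ys} (here refl) px with p y
... | true = tt
anyList⁺ p {xs = y ∷ ys} (there x∈ys) px with p y
... | true  = tt
... | false = anyList⁺ p x∈ys px

anyList⁻ : ∀ {A : Set} (p : A → Bool) xs → T (anyList p xs) → ∃ λ x → x ∈ˡ xs × T (p x)
anyList⁻ p (y ∷ ys) h with p y in eq
... | true  = y , here refl , subst T (sym eq) tt
... | false = let x , x∈ys , px = anyList⁻ p ys h in x , there x∈ys , px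

subᵇ⁻ : ∀ {n} (A B : Subset n) → T (subᵇ A B) → A ⊆ B
subᵇ⁻ {n} A B h {x} x∈A with lookup A x in eqA | allFin⁻ n _ h x
... | true  | Bx = T⇒∈ Bx
... | false | _  = ⊥-elim (subst T eqA (∈⇒T x∈A))

layer⁻ : ∀ {n} (G : Subset n → Bool) t A → T (layer G t A) → T (G A) × ∣ A ∣ ≡ t
layer⁻ G t A h = proj₁ (T-∧⁻ h) , ℕₚ.≡ᵇ⇒≡ _ _ (proj₂ (T-∧⁻ {G A} h))

∈-image⁺ : ∀ {r n} (φ : Vec (Fin n) r) {P x} → x ∈ P → lookup φ x ∈ image φ P
∈-image⁺ {r} φ {P} {x} x∈P = T⇒∈ (subst T (sym (Vecₚ.lookup∘tabulate _ (lookup φ x)))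
  (anyFin⁺ r _ x (T-∧⁺ (∈⇒T x∈P) (fromWitness refl))))

∈-image⁻ : ∀ {r n} (φ : Vec (Fin n) r) {P y} → y ∈ image φ P → ∃ λ x → x ∈ P × lookup φ x ≡ y
∈-image⁻ {r} φ {P} {y} y∈ with anyFin⁻ r _ (subst T (Vecₚ.lookup∘tabulate _ y) (∈⇒T y∈))
... | x , h = x , T⇒∈ (proj₁ (T-∧⁻ h)) , toWitness (proj₂ (T-∧⁻ {lookup P x} h))

∈-bigUnion⁺ : ∀ {n b} (L : Vec (Subset n) b) {y} i → y ∈ lookup L i → y ∈ bigUnion L
∈-bigUnion⁺ (P ∷ L) F.zero    y∈ = x∈p∪q⁺ (inj₁ y∈)
∈-bigUnion⁺ (P ∷ L) (F.suc i) y∈ = x∈p∪q⁺ {p = P} (inj₂ (∈-bigUnion⁺ L i y∈))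

∈-bigUnion⁻ : ∀ {n b} (L : Vec (Subset n) b) {y} → y ∈ bigUnion L → ∃ λ i → y ∈ lookup L i
∈-bigUnion⁻ []      y∈ = ⊥-elim (∉⊥ y∈)
∈-bigUnion⁻ (P ∷ L) y∈ with x∈p∪q⁻ P (bigUnion L) y∈
... | inj₁ y∈P = F.zero , y∈P
... | inj₂ y∈L = let i , y∈Li = ∈-bigUnion⁻ L y∈L in F.suc i , y∈Li

∈-prefixUnion⁺ : ∀ {r b} (K : Fin b → Subset r) i {x} m → toℕ m < toℕ i → x ∈ K m → x ∈ prefixUnion K i
∈-prefixUnion⁺ {b = b} K i {x} m m<i x∈ = T⇒∈ (subst T (sym (Vecₚ.lookup∘tabulate _ x))
  (anyFin⁺ b _ m (T-∧⁺ (ℕₚ.<⇒<ᵇ m<i) (∈⇒T x∈))))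

∈-prefixUnion⁻ : ∀ {r b} (K : Fin b → Subset r) i {x} → x ∈ prefixUnion K i → ∃ λ m → toℕ m < toℕ i × x ∈ K m
∈-prefixUnion⁻ {b = b} K i {x} x∈ with anyFin⁻ b _ (subst T (Vecₚ.lookup∘tabulate _ x) (∈⇒T x∈))
... | m , h = m , ℕₚ.<ᵇ⇒< _ _ (proj₁ (T-∧⁻ h)) , T⇒∈ (proj₂ (T-∧⁻ {toℕ m <ᵇ toℕ i} h))

x∈p─q⇒x∉q : ∀ {n} {x : Fin n} (p q : Subset n) → x ∈ p ─ q → x ∉ q
x∈p─q⇒x∉q (_ ∷ p) (inside ∷ q) () hereᵛ
x∈p─q⇒x∉q (_ ∷ p) (_ ∷ q) (thereᵛ x∈) (thereᵛ x∈q) = x∈p─q⇒x∉q p q x∈ x∈q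

x∈p-y⇒x≢y : ∀ {n} {x y : Fin n} (p : Subset n) → x ∈ p - y → x ≢ y
x∈p-y⇒x≢y {y = y} p x∈ refl = x∈p─q⇒x∉q p ⁅ y ⁆ x∈ (x∈⁅x⁆ y)

x∈p-y⇒x∈p : ∀ {n} {x y : Fin n} (p : Subset n) → x ∈ p - y → x ∈ p
x∈p-y⇒x∈p {y = y} p = p─q⊆p p ⁅ y ⁆

p─q≡p : ∀ {n} (p q : Subset n) → (∀ {x} → x ∈ p → x ∉ q) → p ─ q ≡ p
p─q≡p p q disjoint = ⊆-antisym (p─q⊆p p q) (λ x∈p → x∈p∧x∉q⇒x∈p─q x∈p (disjoint x∈p))

q⊆p⇒p∩q≡q : ∀ {n} (p q : Subset n) → q ⊆ p → p ∩ q ≡ q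
q⊆p⇒p∩q≡q p q q⊆p = ⊆-antisym (p∩q⊆q p q) (λ x∈q → x∈p∩q⁺ (q⊆p x∈q , x∈q))

∣p∣≡1+∣p-x∣ : ∀ {n} {x : Fin n} (p : Subset n) → x ∈ p → ∣ p ∣ ≡ suc ∣ p - x ∣
∣p∣≡1+∣p-x∣ (inside ∷ p)  hereᵛ       = cong (suc ∘ ∣_∣) (sym (p─⊥≡p p))
∣p∣≡1+∣p-x∣ (outside ∷ p) (thereᵛ x∈) = ∣p∣≡1+∣p-x∣ p x∈
∣p∣≡1+∣p-x∣ (inside ∷ p)  (thereᵛ x∈) = cong suc (∣p∣≡1+∣p-x∣ p x∈)

∣p∣≤1+∣p-x∣ : ∀ {n} (p : Subset n) x → ∣ p ∣ ≤ suc ∣ p - x ∣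
∣p∣≤1+∣p-x∣ p x with x ∈? p
... | yes x∈p = ℕₚ.≤-reflexive (∣p∣≡1+∣p-x∣ p x∈p)
... | no  x∉p = ℕₚ.≤-trans (ℕₚ.≤-reflexive (cong ∣_∣ (sym (p─q≡p p ⁅ x ⁆ avoids-x))))
                           (ℕₚ.n≤1+n _)
  where
  avoids-x : ∀ {y} → y ∈ p → y ∉ ⁅ x ⁆
  avoids-x y∈p y∈⁅x⁆ = x∉p (subst (_∈ p) (x∈⁅y⁆⇒x≡y x y∈⁅x⁆) y∈p)

∣p─q∣+∣p∩q∣≡∣p∣ : ∀ {n} (p q : Subset n) → ∣ p ─ q ∣ + ∣ p ∩ q ∣ ≡ ∣ p ∣
∣p─q∣+∣p∩q∣≡∣p∣ []            []            = refl
∣p─q∣+∣p∩q∣≡∣p∣ (outside ∷ p) (outside ∷ q) = ∣p─q∣+∣p∩q∣≡∣p∣ p q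
∣p─q∣+∣p∩q∣≡∣p∣ (outside ∷ p) (inside ∷ q)  = ∣p─q∣+∣p∩q∣≡∣p∣ p q
∣p─q∣+∣p∩q∣≡∣p∣ (inside ∷ p)  (outside ∷ q) = cong suc (∣p─q∣+∣p∩q∣≡∣p∣ p q)
∣p─q∣+∣p∩q∣≡∣p∣ (inside ∷ p)  (inside ∷ q)  =
  trans (ℕₚ.+-suc _ _) (cong suc (∣p─q∣+∣p∩q∣≡∣p∣ p q))

∣p∣≡0⇒x∉p : ∀ {n} {x : Fin n} (p : Subset n) → ∣ p ∣ ≡ 0 → x ∉ p
∣p∣≡0⇒x∉p p ∣p∣≡0 x∈p = ℕₚ.n≮0 (subst (∣ p - _ ∣ <_) ∣p∣≡0 (x∈p⇒∣p-x∣<∣p∣ x∈p))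

Empty⇒∣p∣≡0 : ∀ {n} (p : Subset n) → Empty p → ∣ p ∣ ≡ 0
Empty⇒∣p∣≡0 {n} p empty = trans (cong ∣_∣ (Empty-unique empty)) (∣⊥∣≡0 n)

∣p∣≡1+c⇒Nonempty : ∀ {n c} (p : Subset n) → ∣ p ∣ ≡ suc c → Nonempty p
∣p∣≡1+c⇒Nonempty p ∣p∣≡1+c with nonempty? p
... | yes ne  = ne
... | no  ¬ne = ⊥-elim (ℕₚ.0≢1+n (trans (sym (Empty⇒∣p∣≡0 p ¬ne)) ∣p∣≡1+c))

∣p∣≡1+c⇒∣p-x∣≡c : ∀ {n c} {x : Fin n} (p : Subset n) → x ∈ p → ∣ p ∣ ≡ suc c → ∣ p - x ∣ ≡ c
∣p∣≡1+c⇒∣p-x∣≡c p x∈p ∣p∣≡1+c = ℕₚ.suc-injective (trans (sym (∣p∣≡1+∣p-x∣ p x∈p)) ∣p∣≡1+c)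

module _ {r n : ℕ} where

  MapsInto : Vec (Fin n) r → Subset r → Subset n → Set
  MapsInto φ P Q = ∀ {x} → x ∈ P → lookup φ x ∈ Q

  Covers : Vec (Fin n) r → Subset r → Subset n → Set
  Covers φ P Q = ∀ {y} → y ∈ Q → ∃ λ x → x ∈ P × lookup φ x ≡ y

  InjectiveOn : Vec (Fin n) r → Subset r → Set
  InjectiveOn φ P = ∀ {x y} → x ∈ P → y ∈ P → lookup φ x ≡ lookup φ y → x ≡ y

  image-cong : ∀ (φ ψ : Vec (Fin n) r) {P} → (∀ {x} → x ∈ P → lookup φ x ≡ lookup ψ x) → image φ P ≡ image ψ P
  image-cong φ ψ {P} φ≗ψ = ⊆-antisym (⊆-image φ ψ φ≗ψ) (⊆-image ψ φ (sym ∘ φ≗ψ))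
    where
    ⊆-image : ∀ (φ ψ : Vec (Fin n) r) → (∀ {x} → x ∈ P → lookup φ x ≡ lookup ψ x) → image φ P ⊆ image ψ P
    ⊆-image φ ψ φ≗ψ y∈ = let x , x∈P , φx≡y = ∈-image⁻ φ y∈ in
      subst (_∈ image ψ P) (trans (sym (φ≗ψ x∈P)) φx≡y) (∈-image⁺ ψ x∈P)

  covers-remove : ∀ φ {P Q} x → Covers φ P Q → Covers φ (P - x) (Q - lookup φ x)
  covers-remove φ {P} {Q} x cov {y} y∈ with cov (x∈p-y⇒x∈p Q y∈)
  ... | z , z∈P , φz≡y with z Finₚ.≟ x
  ... | yes refl = ⊥-elim (x∈p-y⇒x≢y Q y∈ (sym φz≡y))
  ... | no  z≢x  = z , x∈p∧x≢y⇒x∈p-y z∈P z≢x , φz≡y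

  covers⇒∣Q∣≤∣P∣ : ∀ φ {P Q} → Covers φ P Q → ∣ Q ∣ ≤ ∣ P ∣
  covers⇒∣Q∣≤∣P∣ φ {P} = go ∣ P ∣ refl
    where
    go : ∀ c {P Q} → ∣ P ∣ ≡ c → Covers φ P Q → ∣ Q ∣ ≤ c
    go zero {P} {Q} ∣P∣≡0 cov = ℕₚ.≤-reflexive (Empty⇒∣p∣≡0 Q λ (_ , y∈Q) →
      let _ , x∈P , _ = cov y∈Q in ∣p∣≡0⇒x∉p P ∣P∣≡0 x∈P)
    go (suc c) {P} {Q} ∣P∣≡1+c cov with ∣p∣≡1+c⇒Nonempty P ∣P∣≡1+c
    ... | x , x∈P = ℕₚ.≤-trans (∣p∣≤1+∣p-x∣ Q (lookup φ x))
      (s≤s (go c (∣p∣≡1+c⇒∣p-x∣≡c P x∈P ∣P∣≡1+c) (covers-remove φ x cov)))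

  injection⇒∣P∣≤∣Q∣ : ∀ φ {P Q} → MapsInto φ P Q → InjectiveOn φ P → ∣ P ∣ ≤ ∣ Q ∣
  injection⇒∣P∣≤∣Q∣ φ {P} = go ∣ P ∣ refl
    where
    go : ∀ c {P Q} → ∣ P ∣ ≡ c → MapsInto φ P Q → InjectiveOn φ P → c ≤ ∣ Q ∣
    go zero    _ _ _ = z≤n
    go (suc c) {P} {Q} ∣P∣≡1+c into inj with ∣p∣≡1+c⇒Nonempty P ∣P∣≡1+c
    ... | x , x∈P = ℕₚ.≤-trans (s≤s (go c (∣p∣≡1+c⇒∣p-x∣≡c P x∈P ∣P∣≡1+c) into′ inj′))
      (ℕₚ.≤-reflexive (sym (∣p∣≡1+∣p-x∣ Q (into x∈P))))
      where
      into′ : MapsInto φ (P - x) (Q - lookup φ x)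
      into′ z∈ = x∈p∧x≢y⇒x∈p-y (into (x∈p-y⇒x∈p P z∈))
        (x∈p-y⇒x≢y P z∈ ∘ inj (x∈p-y⇒x∈p P z∈) x∈P)
      inj′ : InjectiveOn φ (P - x)
      inj′ u∈ v∈ = inj (x∈p-y⇒x∈p P u∈) (x∈p-y⇒x∈p P v∈)

  bijection⇒∣P∣≡∣Q∣ : ∀ φ {P Q} → MapsInto φ P Q → InjectiveOn φ P → Covers φ P Q → ∣ P ∣ ≡ ∣ Q ∣
  bijection⇒∣P∣≡∣Q∣ φ into inj cov =
    ℕₚ.≤-antisym (injection⇒∣P∣≤∣Q∣ φ into inj) (covers⇒∣Q∣≤∣P∣ φ cov)

  record Reassigns (φ φ′ : Vec (Fin n) r) (N : Subset r) (Q : Subset n) : Set where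
    field
      agrees    : ∀ {x} → x ∉ N → lookup φ′ x ≡ lookup φ x
      into      : MapsInto φ′ N Q
      injective : InjectiveOn φ′ N
      onto      : Covers φ′ N Q

  reassign-insert : ∀ {φ φ₁ N Q x y} → x ∈ N → y ∈ Q → Reassigns φ φ₁ (N - x) (Q - y)
    → Reassigns φ (φ₁ [ x ]≔ y) N Q
  reassign-insert {φ} {φ₁} {N} {Q} {x} {y} x∈N y∈Q rest = record
    { agrees = agrees′ ; into = into′ ; injective = injective′ ; onto = onto′ }
    where
    module R = Reassigns rest
    φ′ = φ₁ [ x ]≔ y
    at-x : lookup φ′ x ≡ y
    at-x = Vecₚ.lookup∘update x φ₁ y
    off-x : ∀ {z} → z ≢ x → lookup φ′ z ≡ lookup φ₁ z
    off-x z≢x = Vecₚ.lookup∘update′ z≢x φ₁ y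
    rest-into : ∀ {z} → z ∈ N - x → lookup φ′ z ∈ Q - y
    rest-into z∈ = subst (_∈ Q - y) (sym (off-x (x∈p-y⇒x≢y N z∈))) (R.into z∈)
    agrees′ : ∀ {z} → z ∉ N → lookup φ′ z ≡ lookup φ z
    agrees′ z∉N = trans (off-x λ { refl → z∉N x∈N }) (R.agrees (z∉N ∘ x∈p-y⇒x∈p N))
    into′ : MapsInto φ′ N Q
    into′ {z} z∈N with z Finₚ.≟ x
    ... | yes refl = subst (_∈ Q) (sym at-x) y∈Q
    ... | no  z≢x  = x∈p-y⇒x∈p Q (rest-into (x∈p∧x≢y⇒x∈p-y z∈N z≢x))
    injective′ : InjectiveOn φ′ N
    injective′ {u} {v} u∈N v∈N φ′u≡φ′v with u Finₚ.≟ x | v Finₚ.≟ x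
    ... | yes refl | yes refl = refl
    ... | yes refl | no  v≢x  = ⊥-elim (x∈p-y⇒x≢y Q (rest-into (x∈p∧x≢y⇒x∈p-y v∈N v≢x))
                                  (trans (sym φ′u≡φ′v) at-x))
    ... | no  u≢x  | yes refl = ⊥-elim (x∈p-y⇒x≢y Q (rest-into (x∈p∧x≢y⇒x∈p-y u∈N u≢x))
                                  (trans φ′u≡φ′v at-x))
    ... | no  u≢x  | no  v≢x  = R.injective (x∈p∧x≢y⇒x∈p-y u∈N u≢x) (x∈p∧x≢y⇒x∈p-y v∈N v≢x)
                                  (trans (sym (off-x u≢x)) (trans φ′u≡φ′v (off-x v≢x)))
    onto′ : Covers φ′ N Q
    onto′ {w} w∈Q with w Finₚ.≟ y
    ... | yes refl = x , x∈N , at-x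
    ... | no  w≢y  = let z , z∈ , φ₁z≡w = R.onto (x∈p∧x≢y⇒x∈p-y w∈Q w≢y) in
      z , x∈p-y⇒x∈p N z∈ , trans (off-x (x∈p-y⇒x≢y N z∈)) φ₁z≡w

  reassign : ∀ φ {N Q} → ∣ N ∣ ≡ ∣ Q ∣ → ∃ λ φ′ → Reassigns φ φ′ N Q
  reassign φ {N} ∣N∣≡∣Q∣ = go ∣ N ∣ refl ∣N∣≡∣Q∣
    where
    go : ∀ c {N Q} → ∣ N ∣ ≡ c → ∣ N ∣ ≡ ∣ Q ∣ → ∃ λ φ′ → Reassigns φ φ′ N Q
    go zero {N} {Q} ∣N∣≡0 ∣N∣≡∣Q∣ = φ , record
      { agrees    = λ _ → refl
      ; into      = λ x∈ → ⊥-elim (∣p∣≡0⇒x∉p N ∣N∣≡0 x∈)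
      ; injective = λ x∈ → ⊥-elim (∣p∣≡0⇒x∉p N ∣N∣≡0 x∈)
      ; onto      = λ y∈ → ⊥-elim (∣p∣≡0⇒x∉p Q (trans (sym ∣N∣≡∣Q∣) ∣N∣≡0) y∈)
      }
    go (suc c) {N} {Q} ∣N∣≡1+c ∣N∣≡∣Q∣ =
      let ∣Q∣≡1+c = trans (sym ∣N∣≡∣Q∣) ∣N∣≡1+c
          x , x∈N = ∣p∣≡1+c⇒Nonempty N ∣N∣≡1+c
          y , y∈Q = ∣p∣≡1+c⇒Nonempty Q ∣Q∣≡1+c
          φ₁ , rest = go c (∣p∣≡1+c⇒∣p-x∣≡c N x∈N ∣N∣≡1+c)
                        (trans (∣p∣≡1+c⇒∣p-x∣≡c N x∈N ∣N∣≡1+c) (sym (∣p∣≡1+c⇒∣p-x∣≡c Q y∈Q ∣Q∣≡1+c)))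
      in φ₁ [ x ]≔ y , reassign-insert x∈N y∈Q rest

[]≔-injective : ∀ {A : Set} {k} (xs : Vec A k) i x y → xs [ i ]≔ x ≡ xs [ i ]≔ y → x ≡ y
[]≔-injective xs i x y eq = begin
  x                      ≡⟨ Vecₚ.lookup∘update i xs x ⟨
  lookup (xs [ i ]≔ x) i ≡⟨ cong (λ ys → lookup ys i) eq ⟩
  lookup (xs [ i ]≔ y) i ≡⟨ Vecₚ.lookup∘update i xs y ⟩
  y                      ∎
  where open ≡-Reasoning

[]≔-restore : ∀ {A : Set} {k} (xs : Vec A k) i {x} y → lookup xs i ≡ x → xs ≡ (xs [ i ]≔ y) [ i ]≔ x
[]≔-restore xs i {x} y xs[i]≡x = begin
  xs                      ≡⟨ Vecₚ.[]≔-lookup xs i ⟨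
  xs [ i ]≔ lookup xs i   ≡⟨ cong (xs [ i ]≔_) xs[i]≡x ⟩
  xs [ i ]≔ x             ≡⟨ Vecₚ.[]≔-idempotent xs i ⟨
  (xs [ i ]≔ y) [ i ]≔ x  ∎
  where open ≡-Reasoning

Distinct : ∀ {A K : Set} → (A → K) → List A → Set
Distinct key = AllPairs (λ x y → key x ≢ key y)

distinct-map : ∀ {A B K₁ K₂ : Set} {k₁ : A → K₁} {k₂ : B → K₂} (f : A → B) {xs}
  → (∀ {a a′} → k₂ (f a) ≡ k₂ (f a′) → k₁ a ≡ k₁ a′)
  → Distinct k₁ xs → Distinct k₂ (map f xs)
distinct-map f reflects = AllPairsₚ.map⁺ ∘ AllPairs.map (_∘ reflects)

distinct-concatMap : ∀ {A B K₁ K₂ : Set} {k₁ : A → K₁} {k₂ : B → K₂} (f : A → List B) {xs}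
  → Distinct k₁ xs → (∀ {a} → a ∈ˡ xs → Distinct k₂ (f a))
  → (∀ {a a′ u v} → k₁ a ≢ k₁ a′ → u ∈ˡ f a → v ∈ˡ f a′ → k₂ u ≢ k₂ v)
  → Distinct k₂ (concatMap f xs)
distinct-concatMap f distinct each across = AllPairsₚ.concat⁺
  (Allₚ.map⁺ (All.tabulate each))
  (AllPairsₚ.map⁺ (AllPairs.map (λ k₁a≢k₁a′ →
    All.tabulate λ u∈ → All.tabulate λ v∈ → across k₁a≢k₁a′ u∈ v∈) distinct))

indicator : Bool → ℕ
indicator true  = 1
indicator false = 0

countList-∷ : ∀ {A : Set} (p : A → Bool) x xs → countList p (x ∷ xs) ≡ indicator (p x) + countList p xs
countList-∷ p x xs with p x
... | true  = refl
... | false = refl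

remove : ∀ {A : Set} {x : A} ys → x ∈ˡ ys → List A
remove (_ ∷ ys) (here _)   = ys
remove (y ∷ ys) (there x∈) = y ∷ remove ys x∈

countList-remove : ∀ {A : Set} (p : A → Bool) {x} ys (x∈ : x ∈ˡ ys) → T (p x)
  → countList p ys ≡ suc (countList p (remove ys x∈))
countList-remove p (y ∷ ys) (here refl) px with p y
... | true = refl
countList-remove p (y ∷ ys) (there x∈) px with p y
... | true  = cong suc (countList-remove p ys x∈ px)
... | false = countList-remove p ys x∈ px

∈-remove : ∀ {A : Set} {x z : A} ys (x∈ : x ∈ˡ ys) → z ∈ˡ ys → z ≢ x → z ∈ˡ remove ys x∈
∈-remove (y ∷ ys) (here refl) (here refl) z≢x = ⊥-elim (z≢x refl)
∈-remove (y ∷ ys) (here refl) (there z∈)  z≢x = z∈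
∈-remove (y ∷ ys) (there x∈)  (here refl) z≢x = here refl
∈-remove (y ∷ ys) (there x∈)  (there z∈)  z≢x = there (∈-remove ys x∈ z∈ z≢x)

unique⇒length≤countList : ∀ {A : Set} (p : A → Bool) {xs ys} → Unique xs
  → (∀ {x} → x ∈ˡ xs → x ∈ˡ ys × T (p x)) → length xs ≤ countList p ys
unique⇒length≤countList p {[]}     _              _    = z≤n
unique⇒length≤countList p {x ∷ xs} {ys} (x∉xs ∷ u) good = ℕₚ.≤-trans
  (s≤s (unique⇒length≤countList p u good′))
  (ℕₚ.≤-reflexive (sym (countList-remove p ys x∈ys (proj₂ (good (here refl))))))
  where
  x∈ys = proj₁ (good (here refl))
  good′ : ∀ {z} → z ∈ˡ xs → z ∈ˡ remove ys x∈ys × T (p z)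
  good′ z∈ = ∈-remove ys x∈ys (proj₁ (good (there z∈))) (λ { refl → All.lookup x∉xs z∈ refl })
           , proj₂ (good (there z∈))

length-concatMap≥ : ∀ {A B : Set} (f : A → List B) c xs → (∀ {x} → x ∈ˡ xs → c ≤ length (f x))
  → length xs * c ≤ length (concatMap f xs)
length-concatMap≥ f c []       _     = z≤n
length-concatMap≥ f c (x ∷ xs) large = ℕₚ.≤-trans
  (ℕₚ.+-mono-≤ (large (here refl)) (length-concatMap≥ f c xs (large ∘ there)))
  (ℕₚ.≤-reflexive (sym (Listₚ.length-++ (f x))))

consIf : ∀ {B : Set} (b : Bool) → (T b → B) → List B → List B
consIf true  f ys = f tt ∷ ys
consIf false f ys = ys

length-consIf : ∀ {B : Set} b (f : T b → B) ys → length (consIf b f ys) ≡ indicator b + length ys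
length-consIf true  f ys = refl
length-consIf false f ys = refl

map-consIf : ∀ {B C : Set} (g : B → C) b (f : T b → B) ys → map g (consIf b f ys) ≡ consIf b (g ∘ f) (map g ys)
map-consIf g true  f ys = refl
map-consIf g false f ys = refl

select : ∀ {A : Set} (p : A → Bool) → List A → List (Σ A (T ∘ p))
select p []       = []
select p (x ∷ xs) = consIf (p x) (x ,_) (select p xs)

length-select : ∀ {A : Set} (p : A → Bool) xs → length (select p xs) ≡ countList p xs
length-select p []       = refl
length-select p (x ∷ xs) = begin
  length (consIf (p x) (x ,_) (select p xs))  ≡⟨ length-consIf (p x) (x ,_) (select p xs) ⟩
  indicator (p x) + length (select p xs)      ≡⟨ cong (indicator (p x) +_) (length-select p xs) ⟩
  indicator (p x) + countList p xs            ≡⟨ countList-∷ p x xs ⟨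
  countList p (x ∷ xs)                        ∎
  where open ≡-Reasoning

map-proj₁-select : ∀ {A : Set} (p : A → Bool) xs → map proj₁ (select p xs) ≡ filter (T? ∘ p) xs
map-proj₁-select p []       = refl
map-proj₁-select p (x ∷ xs) rewrite map-consIf proj₁ (p x) (x ,_) (select p xs) with p x
... | true  = cong (x ∷_) (map-proj₁-select p xs)
... | false = map-proj₁-select p xs

distinct-select : ∀ {A : Set} (p : A → Bool) {xs} → Unique xs → Distinct proj₁ (select p xs)
distinct-select p {xs} u = AllPairsₚ.map⁻
  (subst Unique (sym (map-proj₁-select p xs)) (Uniqueₚ.filter⁺ (T? ∘ p) u))

∈-allFins : ∀ n (x : Fin n) → x ∈ˡ allFins n
∈-allFins (suc n) F.zero    = here refl
∈-allFins (suc n) (F.suc x) = there (∈ˡₚ.∈-map⁺ F.suc (∈-allFins n x))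

∈-allSubsets : ∀ n (P : Subset n) → P ∈ˡ allSubsets n
∈-allSubsets zero    []          = here refl
∈-allSubsets (suc n) (true ∷ P)  = ∈ˡₚ.∈-++⁺ˡ (∈ˡₚ.∈-map⁺ (true ∷_) (∈-allSubsets n P))
∈-allSubsets (suc n) (false ∷ P) =
  ∈ˡₚ.∈-++⁺ʳ (map (true ∷_) (allSubsets n)) (∈ˡₚ.∈-map⁺ (false ∷_) (∈-allSubsets n P))

∈-allVecs : ∀ {A : Set} (xs : List A) {k} (v : Vec A k) → (∀ i → lookup v i ∈ˡ xs) → v ∈ˡ allVecs xs k
∈-allVecs xs []      _      = here refl
∈-allVecs xs (a ∷ v) entries = ∈ˡₚ.∈-concatMap⁺ (λ x → map (x ∷_) (allVecs xs _))
  (lose (entries F.zero) (∈ˡₚ.∈-map⁺ (a ∷_) (∈-allVecs xs v (entries ∘ F.suc))))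

∈-copyCandidates : ∀ {n r b} (L : Vec (Subset n) b) (φ : Vec (Fin n) r)
  → (L , φ) ∈ˡ concatMap (λ L → map (L ,_) (allVecs (allFins n) r)) (allVecs (allSubsets n) b)
∈-copyCandidates {n} {r} L φ = ∈ˡₚ.∈-concatMap⁺ (λ L → map (L ,_) (allVecs (allFins n) r))
  (lose (∈-allVecs (allSubsets n) L (λ _ → ∈-allSubsets n _))
        (∈ˡₚ.∈-map⁺ (L ,_) (∈-allVecs (allFins n) φ (λ _ → ∈-allFins n _))))

unique-allSubsets : ∀ n → Unique (allSubsets n)
unique-allSubsets zero    = [] ∷ []
unique-allSubsets (suc n) = Uniqueₚ.++⁺
  (Uniqueₚ.map⁺ (cong Data.Vec.tail) (unique-allSubsets n))
  (Uniqueₚ.map⁺ (cong Data.Vec.tail) (unique-allSubsets n))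
  λ (v∈true , v∈false) → head-differs (∈ˡₚ.∈-map⁻ (true ∷_) v∈true) (∈ˡₚ.∈-map⁻ (false ∷_) v∈false)
  where
  head-differs : ∀ {v : Subset (suc n)} → (∃ λ P → P ∈ˡ allSubsets n × v ≡ true ∷ P)
    → ¬ (∃ λ P → P ∈ˡ allSubsets n × v ≡ false ∷ P)
  head-differs (_ , _ , refl) (_ , _ , ())

countFin-suc : ∀ n (p : Fin (suc n) → Bool) → countFin (suc n) p ≡ indicator (p F.zero) + countFin n (p ∘ F.suc)
countFin-suc n p with p F.zero
... | true  = refl
... | false = refl

countFin-cong : ∀ n {p q : Fin n → Bool} → (∀ i → p i ≡ q i) → countFin n p ≡ countFin n q
countFin-cong zero    p≗q = refl
countFin-cong (suc n) {p} {q} p≗q = begin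
  countFin (suc n) p                                ≡⟨ countFin-suc n p ⟩
  indicator (p F.zero) + countFin n (p ∘ F.suc)     ≡⟨ cong₂ _+_ (cong indicator (p≗q F.zero))
                                                               (countFin-cong n (p≗q ∘ F.suc)) ⟩
  indicator (q F.zero) + countFin n (q ∘ F.suc)     ≡⟨ countFin-suc n q ⟨
  countFin (suc n) q                                ∎
  where open ≡-Reasoning

countFin-false : ∀ n (p : Fin n → Bool) → (∀ i → p i ≡ false) → countFin n p ≡ 0
countFin-false zero    p none = refl
countFin-false (suc n) p none = trans (countFin-suc n p)
  (cong₂ _+_ (cong indicator (none F.zero)) (countFin-false n (p ∘ F.suc) (none ∘ F.suc)))

countBelow : ℕ → (n : ℕ) → (Fin n → Bool) → ℕ
countBelow m n q = countFin n (λ i → (toℕ i <ᵇ m) ∧ q i)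

countBelow-zero : ∀ n q → countBelow 0 n q ≡ 0
countBelow-zero n q = countFin-false n _ (λ _ → refl)

countBelow-suc : ∀ n m q (m<n : m < n) → countBelow (suc m) n q ≡ countBelow m n q + indicator (q (fromℕ< m<n))
countBelow-suc (suc n) zero q _ = begin
  countBelow 1 (suc n) q                 ≡⟨ countFin-suc n (λ i → (toℕ i <ᵇ 1) ∧ q i) ⟩
  indicator (q F.zero) + countBelow 0 n (q ∘ F.suc)  ≡⟨ cong (indicator (q F.zero) +_) (countBelow-zero n (q ∘ F.suc)) ⟩
  indicator (q F.zero) + 0               ≡⟨ ℕₚ.+-comm (indicator (q F.zero)) 0 ⟩
  indicator (q F.zero)                   ≡⟨ cong (_+ indicator (q F.zero)) (countBelow-zero (suc n) q) ⟨
  countBelow 0 (suc n) q + indicator (q F.zero) ∎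
  where open ≡-Reasoning
countBelow-suc (suc n) (suc m) q (s≤s m<n) = begin
  countBelow (2 + m) (suc n) q                                         ≡⟨ countFin-suc n (λ i → (toℕ i <ᵇ 2 + m) ∧ q i) ⟩
  indicator (q F.zero) + countBelow (suc m) n (q ∘ F.suc)              ≡⟨ cong (indicator (q F.zero) +_)
                                                                            (countBelow-suc n m (q ∘ F.suc) m<n) ⟩
  indicator (q F.zero) + (countBelow m n (q ∘ F.suc) + indicator (q (F.suc (fromℕ< m<n))))
                                                                       ≡⟨ ℕₚ.+-assoc (indicator (q F.zero)) _ _ ⟨
  indicator (q F.zero) + countBelow m n (q ∘ F.suc) + indicator (q (F.suc (fromℕ< m<n)))
                                                                       ≡⟨ cong (_+ indicator (q (F.suc (fromℕ< m<n)))) (countFin-suc n (λ i → (toℕ i <ᵇ suc m) ∧ q i)) ⟨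
  countBelow (suc m) (suc n) q + indicator (q (F.suc (fromℕ< m<n)))   ∎
  where open ≡-Reasoning

countBelow-all : ∀ n q → countBelow n n q ≡ countFin n q
countBelow-all n q = countFin-cong n below
  where
  below : ∀ i → ((toℕ i <ᵇ n) ∧ q i) ≡ q i
  below i rewrite Equivalence.to Boolₚ.T-≡ (ℕₚ.<⇒<ᵇ (Finₚ.toℕ<n i)) = refl

prodFin-cong : ∀ s {f g : Fin s → ℕ} → (∀ k → f k ≡ g k) → prodFin s f ≡ prodFin s g
prodFin-cong zero    f≗g = refl
prodFin-cong (suc s) f≗g = cong₂ _*_ (f≗g F.zero) (prodFin-cong s (f≗g ∘ F.suc))

prodFin-* : ∀ s (f g : Fin s → ℕ) → prodFin s (λ k → f k * g k) ≡ prodFin s f * prodFin s g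
prodFin-* zero    f g = refl
prodFin-* (suc s) f g = trans (cong (f F.zero * g F.zero *_) (prodFin-* s (f ∘ F.suc) (g ∘ F.suc)))
  (ℕₚ.[m*n]*[o*p]≡[m*o]*[n*p] (f F.zero) (g F.zero) _ _)

prodFin-1 : ∀ s (f : Fin s → ℕ) → (∀ k → f k ≡ 1) → prodFin s f ≡ 1
prodFin-1 zero    f ones = refl
prodFin-1 (suc s) f ones = cong₂ _*_ (ones F.zero) (prodFin-1 s (f ∘ F.suc) (ones ∘ F.suc))

prodFin-^-+ : ∀ s (B d e : Fin s → ℕ) → prodFin s (λ k → B k ^ (d k + e k)) ≡ prodFin s (λ k → B k ^ d k) * prodFin s (λ k → B k ^ e k)
prodFin-^-+ s B d e = trans (prodFin-cong s (λ k → ℕₚ.^-distribˡ-+-* (B k) (d k) (e k))) (prodFin-* s _ _)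

prodFin-^-indicator : ∀ s (B : Fin s → ℕ) (g : Fin s → Bool) k₀ → (∀ k → T (g k) → k ≡ k₀) → T (g k₀)
  → prodFin s (λ k → B k ^ indicator (g k)) ≡ B k₀
prodFin-^-indicator (suc s) B g F.zero only gk₀ with g F.zero
... | true = trans (cong₂ _*_ (ℕₚ.*-identityʳ (B F.zero)) (prodFin-1 s _ others)) (ℕₚ.*-identityʳ (B F.zero))
  where
  others : ∀ k → B (F.suc k) ^ indicator (g (F.suc k)) ≡ 1
  others k with g (F.suc k) in eq
  ... | false = refl
  ... | true  with () ← only (F.suc k) (subst T (sym eq) tt)
prodFin-^-indicator (suc s) B g (F.suc k₀) only gk₀ with g F.zero in eq
... | true  with () ← only F.zero (subst T (sym eq) tt)
... | false = trans (ℕₚ.+-identityʳ _)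
  (prodFin-^-indicator s (B ∘ F.suc) (g ∘ F.suc) k₀ (λ k gk → Finₚ.suc-injective (only (F.suc k) gk)) gk₀)

prodFin-^-countBelow-suc : ∀ s b m (B : Fin s → ℕ) (q : Fin s → Fin b → Bool) (m<b : m < b)
  → prodFin s (λ k → B k ^ countBelow (suc m) b (q k))
  ≡ prodFin s (λ k → B k ^ countBelow m b (q k)) * prodFin s (λ k → B k ^ indicator (q k (fromℕ< m<b)))
prodFin-^-countBelow-suc s b m B q m<b = trans
  (prodFin-cong s λ k → cong (B k ^_) (countBelow-suc b m (q k) m<b))
  (prodFin-^-+ s B (λ k → countBelow m b (q k)) (λ k → indicator (q k (fromℕ< m<b))))

∈-minus : ∀ {n} (G : Subset n → Bool) {S A} → T (G A) → Nonempty A → (∀ {y} → y ∈ A → y ∉ S)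
  → T (minus G S A)
∈-minus {n} G {S} {A} A∈G (y , y∈A) A∩S≡∅ = anyList⁺ _ (∈-allSubsets n A)
  (T-∧⁺ A∈G (T-∧⁺ (T-not⁺ λ A⊆S → A∩S≡∅ y∈A (subᵇ⁻ A S A⊆S y∈A))
                  (fromWitness (p─q≡p A S A∩S≡∅))))

-- If the preimage K of L met S, then ∣ L ∣ = ∣ K ─ S ∣ < ∣ K ∣ ≤ t.
minus-top : ∀ {n t} {G : Subset n → Bool} {S L} → IsTComplex t G → T (minus G S L) → ∣ L ∣ ≡ t
  → T (G L) × (∀ {y} → y ∈ L → y ∉ S)
minus-top {n} {t} {G} {S} {L} complex L∈ ∣L∣≡t with anyList⁻ _ (allSubsets n) L∈
... | K , _ , K∈ = subst (T ∘ G) K≡L K∈G , λ y∈L → K∩S≡∅ (subst (_ ∈_) (sym K≡L) y∈L)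
  where
  K∈G : T (G K)
  K∈G = proj₁ (T-∧⁻ K∈)
  K─S≡L : K ─ S ≡ L
  K─S≡L = toWitness (proj₂ (T-∧⁻ {not (subᵇ K S)} (proj₂ (T-∧⁻ {G K} K∈))))
  K∩S≡∅ : ∀ {y} → y ∈ K → y ∉ S
  K∩S≡∅ y∈K y∈S = ℕₚ.<-irrefl refl (ℕₚ.<-≤-trans
    (subst (λ z → ∣ z ∣ < ∣ K ∣) K─S≡L (p∩q≢∅⇒∣p─q∣<∣p∣ K S (_ , x∈p∩q⁺ (y∈K , y∈S))))
    (ℕₚ.≤-trans (proj₂ (proj₁ (complex K K∈G))) (ℕₚ.≤-reflexive (sym ∣L∣≡t))))
  K≡L : K ≡ L
  K≡L = trans (sym (p─q≡p K S K∩S≡∅)) K─S≡L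

layerSize-Fin0≡0 : ∀ {t} (G : Subset 0 → Bool) → IsTComplex t G → layerSize G t ≡ 0
layerSize-Fin0≡0 G complex with G [] in eq
... | false = refl
... | true  with () ← proj₁ (proj₁ (complex [] (subst T (sym eq) tt)))

-- Greedy construction of copies

module Construction
  {t s ℓ r b n : ℕ} (B : Fin s → ℕ) (K : Fin b → Subset r) (j : Fin b → Fin b)
  (K-size : ∀ i → ∣ K i ∣ ≡ t)
  (K-covers : ∀ x → ∃ λ i → x ∈ K i)
  (K-glued : ∀ i → 1 ≤ toℕ i →
    toℕ (j i) < toℕ i × K i ∩ prefixUnion K i ≡ glue K j i × Nonempty (glue K j i))
  (glue≤s : GlueAtMost K j s)
  (G : Subset n → Bool) (complex : IsTComplex t G) (builder : IsStrongBuilder t s ℓ r B G)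
  where

  Placed : ℕ → Fin r → Set
  Placed m x = ∃ λ i → toℕ i < m × x ∈ K i

  -- Unused slots hold ⊥, so that a partial copy determines the one it was extended from.
  record IsPartialCopy (m : ℕ) (L : Vec (Subset n) b) (φ : Vec (Fin n) r) : Set where
    field
      members   : ∀ i → toℕ i < m → T (G (lookup L i))
      image-K   : ∀ i → toℕ i < m → image φ (K i) ≡ lookup L i
      unused    : ∀ i → m ≤ toℕ i → lookup L i ≡ ⊥
      injective : ∀ {x y} → Placed m x → Placed m y → lookup φ x ≡ lookup φ y → x ≡ y

  record PartialCopy (m : ℕ) : Set where
    constructor partialCopy
    field
      L             : Vec (Subset n) b
      φ             : Vec (Fin n) r
      isPartialCopy : IsPartialCopy m L φ

  glueSizeIs : Fin s → Fin b → Bool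
  glueSizeIs k i = (1 ≤ᵇ toℕ i) ∧ (∣ glue K j i ∣ ≡ᵇ suc (toℕ k))

  glueFactor : ∀ i → 1 ≤ toℕ i →
    ∃ λ k → ∣ glue K j i ∣ ≡ suc (toℕ k) × prodFin s (λ k′ → B k′ ^ indicator (glueSizeIs k′ i)) ≡ B k
  glueFactor i 1≤i = k , ∣glue∣≡1+k , prodFin-^-indicator s B (λ k′ → glueSizeIs k′ i) k only size-k
    where
    x∈glue = proj₂ (proj₂ (K-glued i 1≤i))
    g = ∣ glue K j i - proj₁ x∈glue ∣
    ∣glue∣≡1+g : ∣ glue K j i ∣ ≡ suc g
    ∣glue∣≡1+g = ∣p∣≡1+∣p-x∣ (glue K j i) (proj₂ x∈glue)
    g<s : g < s
    g<s = subst (_≤ s) ∣glue∣≡1+g (glue≤s i 1≤i)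
    k : Fin s
    k = fromℕ< g<s
    ∣glue∣≡1+k : ∣ glue K j i ∣ ≡ suc (toℕ k)
    ∣glue∣≡1+k = trans ∣glue∣≡1+g (cong suc (sym (Finₚ.toℕ-fromℕ< g<s)))
    only : ∀ k′ → T (glueSizeIs k′ i) → k′ ≡ k
    only k′ h = Finₚ.toℕ-injective (ℕₚ.suc-injective
      (trans (sym (ℕₚ.≡ᵇ⇒≡ _ _ (proj₂ (T-∧⁻ {1 ≤ᵇ toℕ i} h)))) ∣glue∣≡1+k))
    size-k : T (glueSizeIs k i)
    size-k = T-∧⁺ (ℕₚ.≤⇒≤ᵇ 1≤i) (ℕₚ.≡⇒≡ᵇ _ _ ∣glue∣≡1+k)

  module Step {m} (m<b : m < b) (c : PartialCopy m) where
    open PartialCopy c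
    open IsPartialCopy isPartialCopy

    i : Fin b
    i = fromℕ< m<b

    toℕi≡m : toℕ i ≡ m
    toℕi≡m = Finₚ.toℕ-fromℕ< m<b

    O N : Subset r
    O = K i ∩ prefixUnion K i
    N = K i ─ prefixUnion K i

    -- O and N are the old and the new vertices of K i, A is the image of the glue O,
    -- and U is the set of vertices used so far.
    A U : Subset n
    A = image φ O
    U = bigUnion L

    prefix⇒placed : ∀ {x} → x ∈ prefixUnion K i → Placed m x
    prefix⇒placed x∈ = let i′ , i′<i , x∈K = ∈-prefixUnion⁻ K i x∈ in i′ , subst (toℕ i′ <_) toℕi≡m i′<i , x∈K

    placed⇒prefix : ∀ {x} → Placed m x → x ∈ prefixUnion K i
    placed⇒prefix (i′ , i′<m , x∈K) = ∈-prefixUnion⁺ K i i′ (subst (toℕ i′ <_) (sym toℕi≡m) i′<m) x∈K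

    placed⇒∉N : ∀ {x} → Placed m x → x ∉ N
    placed⇒∉N placed x∈N = x∈p─q⇒x∉q (K i) (prefixUnion K i) x∈N (placed⇒prefix placed)

    O⇒placed : ∀ {x} → x ∈ O → Placed m x
    O⇒placed x∈O = prefix⇒placed (proj₂ (x∈p∩q⁻ (K i) _ x∈O))

    used : ∀ {y} → y ∈ U → ∃ λ i′ → toℕ i′ < m × y ∈ lookup L i′
    used y∈U with ∈-bigUnion⁻ L y∈U
    ... | i′ , y∈L with m ℕₚ.≤? toℕ i′
    ... | yes m≤i′ = ⊥-elim (∉⊥ (subst (_ ∈_) (unused i′ m≤i′) y∈L))
    ... | no  m≰i′ = i′ , ℕₚ.≰⇒> m≰i′ , y∈L

    U⇒image : ∀ {y} → y ∈ U → ∃ λ x → Placed m x × lookup φ x ≡ y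
    U⇒image y∈U with used y∈U
    ... | i′ , i′<m , y∈L with ∈-image⁻ φ (subst (_ ∈_) (sym (image-K i′ i′<m)) y∈L)
    ... | x , x∈K , φx≡y = x , (i′ , i′<m , x∈K) , φx≡y

    placed⇒U : ∀ {x} → Placed m x → lookup φ x ∈ U
    placed⇒U (i′ , i′<m , x∈K) = ∈-bigUnion⁺ L i′ (subst (_ ∈_) (image-K i′ i′<m) (∈-image⁺ φ x∈K))

    ∣N∣+∣O∣≡t : ∣ N ∣ + ∣ O ∣ ≡ t
    ∣N∣+∣O∣≡t = trans (∣p─q∣+∣p∩q∣≡∣p∣ (K i) (prefixUnion K i)) (K-size i)

    ∣O∣≡∣A∣ : ∣ O ∣ ≡ ∣ A ∣
    ∣O∣≡∣A∣ = bijection⇒∣P∣≡∣Q∣ φ (∈-image⁺ φ)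
      (λ x∈O y∈O → injective (O⇒placed x∈O) (O⇒placed y∈O)) (∈-image⁻ φ)

    record Admissible (L′ : Subset n) : Set where
      field
        member : T (G L′)
        size   : ∣ L′ ∣ ≡ t
        A⊆L′   : A ⊆ L′
        fresh  : ∀ {y} → y ∈ L′ → y ∉ A → y ∉ U

    ∣N∣≡∣L′─A∣ : ∀ {L′} → Admissible L′ → ∣ N ∣ ≡ ∣ L′ ─ A ∣
    ∣N∣≡∣L′─A∣ {L′} admissible = ℕₚ.+-cancelʳ-≡ ∣ O ∣ _ _ (begin
      ∣ N ∣ + ∣ O ∣           ≡⟨ ∣N∣+∣O∣≡t ⟩
      t                       ≡⟨ Admissible.size admissible ⟨
      ∣ L′ ∣                  ≡⟨ ∣p─q∣+∣p∩q∣≡∣p∣ L′ A ⟨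
      ∣ L′ ─ A ∣ + ∣ L′ ∩ A ∣ ≡⟨ cong (λ P → ∣ L′ ─ A ∣ + ∣ P ∣) (q⊆p⇒p∩q≡q L′ A (Admissible.A⊆L′ admissible)) ⟩
      ∣ L′ ─ A ∣ + ∣ A ∣      ≡⟨ cong (∣ L′ ─ A ∣ +_) ∣O∣≡∣A∣ ⟨
      ∣ L′ ─ A ∣ + ∣ O ∣      ∎)
      where open ≡-Reasoning

    earlier : ∀ {i′} → toℕ i′ < suc m → i′ ≢ i → toℕ i′ < m
    earlier {i′} i′<1+m i′≢i with ℕₚ.m≤n⇒m<n∨m≡n (ℕₚ.≤-pred i′<1+m)
    ... | inj₁ i′<m = i′<m
    ... | inj₂ i′≡m = ⊥-elim (i′≢i (Finₚ.toℕ-injective (trans i′≡m (sym toℕi≡m))))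

    module Extend {L′ : Subset n} (admissible : Admissible L′)
                  {φ′ : Vec (Fin n) r} (reassigns : Reassigns φ φ′ N (L′ ─ A)) where
      open Admissible admissible
      open Reassigns reassigns renaming (injective to N-injective)

      L″ : Vec (Subset n) b
      L″ = L [ i ]≔ L′

      placed-agrees : ∀ {x} → Placed m x → lookup φ′ x ≡ lookup φ x
      placed-agrees = agrees ∘ placed⇒∉N

      members″ : ∀ i′ → toℕ i′ < suc m → T (G (lookup L″ i′))
      members″ i′ i′<1+m with i′ Finₚ.≟ i
      ... | yes refl = subst (T ∘ G) (sym (Vecₚ.lookup∘update i L L′)) member
      ... | no  i′≢i = subst (T ∘ G) (sym (Vecₚ.lookup∘update′ i′≢i L L′)) (members i′ (earlier i′<1+m i′≢i))

      image⊆L′ : image φ′ (K i) ⊆ L′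
      image⊆L′ y∈ with ∈-image⁻ φ′ y∈
      ... | x , x∈K , φ′x≡y with x ∈? prefixUnion K i
      ... | yes x∈prefix = subst (_∈ L′) (trans (sym (placed-agrees (prefix⇒placed x∈prefix))) φ′x≡y)
                             (A⊆L′ (∈-image⁺ φ (x∈p∩q⁺ (x∈K , x∈prefix))))
      ... | no  x∉prefix = subst (_∈ L′) φ′x≡y (p─q⊆p L′ A (into (x∈p∧x∉q⇒x∈p─q x∈K x∉prefix)))

      L′⊆image : L′ ⊆ image φ′ (K i)
      L′⊆image {y} y∈L′ with y ∈? A
      ... | yes y∈A = let x , x∈O , φx≡y = ∈-image⁻ φ y∈A in
        subst (_∈ image φ′ (K i)) (trans (placed-agrees (O⇒placed x∈O)) φx≡y)
          (∈-image⁺ φ′ (p∩q⊆p (K i) _ x∈O))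
      ... | no  y∉A = let x , x∈N , φ′x≡y = onto (x∈p∧x∉q⇒x∈p─q y∈L′ y∉A) in
        subst (_∈ image φ′ (K i)) φ′x≡y (∈-image⁺ φ′ (p─q⊆p (K i) _ x∈N))

      image-K″ : ∀ i′ → toℕ i′ < suc m → image φ′ (K i′) ≡ lookup L″ i′
      image-K″ i′ i′<1+m with i′ Finₚ.≟ i
      ... | yes refl = trans (⊆-antisym image⊆L′ L′⊆image) (sym (Vecₚ.lookup∘update i L L′))
      ... | no  i′≢i = begin
        image φ′ (K i′)  ≡⟨ image-cong φ′ φ (λ x∈K → placed-agrees (i′ , i′<m , x∈K)) ⟩
        image φ (K i′)   ≡⟨ image-K i′ i′<m ⟩
        lookup L i′      ≡⟨ Vecₚ.lookup∘update′ i′≢i L L′ ⟨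
        lookup L″ i′     ∎
        where
        open ≡-Reasoning
        i′<m = earlier i′<1+m i′≢i

      unused″ : ∀ i′ → suc m ≤ toℕ i′ → lookup L″ i′ ≡ ⊥
      unused″ i′ 1+m≤i′ = trans (Vecₚ.lookup∘update′ (λ { refl → ℕₚ.<-irrefl (sym toℕi≡m) 1+m≤i′ }) L L′)
        (unused i′ (ℕₚ.≤-trans (ℕₚ.n≤1+n m) 1+m≤i′))

      placed-or-new : ∀ {x} → Placed (suc m) x → Placed m x ⊎ x ∈ N
      placed-or-new {x} (i′ , i′<1+m , x∈K) with i′ Finₚ.≟ i
      ... | no  i′≢i = inj₁ (i′ , earlier i′<1+m i′≢i , x∈K)
      ... | yes refl with x ∈? prefixUnion K i
      ... | yes x∈prefix = inj₁ (prefix⇒placed x∈prefix)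
      ... | no  x∉prefix = inj₂ (x∈p∧x∉q⇒x∈p─q x∈K x∉prefix)

      new≢placed : ∀ {x y} → Placed m x → y ∈ N → lookup φ′ x ≢ lookup φ′ y
      new≢placed placed y∈N φ′x≡φ′y = fresh (p─q⊆p L′ A (into y∈N)) (x∈p─q⇒x∉q L′ A (into y∈N))
        (subst (_∈ U) (trans (sym (placed-agrees placed)) φ′x≡φ′y) (placed⇒U placed))

      injective″ : ∀ {x y} → Placed (suc m) x → Placed (suc m) y → lookup φ′ x ≡ lookup φ′ y → x ≡ y
      injective″ x-placed y-placed φ′x≡φ′y with placed-or-new x-placed | placed-or-new y-placed
      ... | inj₁ x-old | inj₁ y-old = injective x-old y-old
        (trans (sym (placed-agrees x-old)) (trans φ′x≡φ′y (placed-agrees y-old)))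
      ... | inj₂ x∈N   | inj₂ y∈N   = N-injective x∈N y∈N φ′x≡φ′y
      ... | inj₁ x-old | inj₂ y∈N   = ⊥-elim (new≢placed x-old y∈N φ′x≡φ′y)
      ... | inj₂ x∈N   | inj₁ y-old = ⊥-elim (new≢placed y-old x∈N (sym φ′x≡φ′y))

      extended : PartialCopy (suc m)
      extended = partialCopy L″ φ′ record
        { members = members″ ; image-K = image-K″ ; unused = unused″ ; injective = injective″ }

    extend : ∀ L′ → Admissible L′ → PartialCopy (suc m)
    extend L′ admissible = Extend.extended admissible (proj₂ (reassign φ (∣N∣≡∣L′─A∣ admissible)))

    admissible-first : m ≡ 0 → ∀ L′ → T (layer G t L′) → Admissible L′
    admissible-first refl L′ L′∈ = record
      { member = proj₁ (layer⁻ G t L′ L′∈)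
      ; size   = proj₂ (layer⁻ G t L′ L′∈)
      ; A⊆L′   = λ y∈A → let _ , x∈O , _ = ∈-image⁻ φ y∈A ; _ , i′<0 , _ = O⇒placed x∈O in ⊥-elim (ℕₚ.n≮0 i′<0)
      ; fresh  = λ _ _ y∈U → let _ , i′<0 , _ = used y∈U in ℕₚ.n≮0 i′<0
      }

    S : Subset n
    S = U ─ A

    -- deg t (minus G S) A counts exactly these sets.
    candidate : Subset n → Bool
    candidate L′ = layer (minus G S) t L′ ∧ subᵇ A L′

    admissible-next : ∀ L′ → T (candidate L′) → Admissible L′
    admissible-next L′ h = record
      { member = proj₁ member×avoids
      ; size   = ∣L′∣≡t
      ; A⊆L′   = subᵇ⁻ A L′ (proj₂ (T-∧⁻ {layer (minus G S) t L′} h))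
      ; fresh  = λ y∈L′ y∉A y∈U → proj₂ member×avoids y∈L′ (x∈p∧x∉q⇒x∈p─q y∈U y∉A)
      }
      where
      L′∈ = layer⁻ (minus G S) t L′ (proj₁ (T-∧⁻ h))
      ∣L′∣≡t = proj₂ L′∈
      member×avoids = minus-top complex (proj₁ L′∈) ∣L′∣≡t

    enough-candidates : 1 ≤ m → prodFin s (λ k → B k ^ indicator (glueSizeIs k i)) ≤ countList candidate (allSubsets n)
    enough-candidates 1≤m = ℕₚ.≤-trans (ℕₚ.≤-reflexive prod≡Bk)
      (proj₁ (builder S S-vertices ∣S∣≤r) A A∈G∖S k (trans (sym ∣O∣≡∣A∣) (trans (cong ∣_∣ O≡glue) ∣glue∣≡1+k)))
      where
      1≤i = subst (1 ≤_) (sym toℕi≡m) 1≤m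
      k = proj₁ (glueFactor i 1≤i)
      ∣glue∣≡1+k = proj₁ (proj₂ (glueFactor i 1≤i))
      prod≡Bk = proj₂ (proj₂ (glueFactor i 1≤i))
      O≡glue = proj₁ (proj₂ (K-glued i 1≤i))
      j<m : toℕ (j i) < m
      j<m = subst (toℕ (j i) <_) toℕi≡m (proj₁ (K-glued i 1≤i))
      x = proj₁ (proj₂ (proj₂ (K-glued i 1≤i)))
      x∈O : x ∈ O
      x∈O = subst (x ∈_) (sym O≡glue) (proj₂ (proj₂ (proj₂ (K-glued i 1≤i))))
      A⊆Lj : A ⊆ lookup L (j i)
      A⊆Lj y∈A = let x , x∈O , φx≡y = ∈-image⁻ φ y∈A in
        subst (_∈ lookup L (j i)) φx≡y (subst (lookup φ x ∈_) (image-K (j i) j<m)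
          (∈-image⁺ φ (p∩q⊆q (K i) (K (j i)) (subst (x ∈_) O≡glue x∈O))))
      A∈G : T (G A)
      A∈G = proj₂ (complex (lookup L (j i)) (members (j i) j<m)) A A⊆Lj (_ , ∈-image⁺ φ x∈O)
      A∈G∖S : T (minus G S A)
      A∈G∖S = ∈-minus G A∈G (_ , ∈-image⁺ φ x∈O) λ y∈A y∈S → x∈p─q⇒x∉q U A y∈S y∈A
      S-vertices : InVertexSet G S
      S-vertices y∈S = let i′ , i′<m , y∈L = used (p─q⊆p U A y∈S) in lookup L i′ , members i′ i′<m , y∈L
      ∣S∣≤r : ∣ S ∣ ≤ r
      ∣S∣≤r = subst (∣ S ∣ ≤_) (∣⊤∣≡n r) (covers⇒∣Q∣≤∣P∣ φ {⊤} λ y∈S →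
        let x , _ , φx≡y = U⇒image (p─q⊆p U A y∈S) in x , ∈⊤ , φx≡y)

  open PartialCopy

  nextSets : ∀ {m} → m < b → PartialCopy m → Subset n → Bool
  nextSets {zero}  _   _ = layer G t
  nextSets {suc m} m<b c = Step.candidate m<b c

  nextSets-admissible : ∀ {m} (m<b : m < b) c L′ → T (nextSets m<b c L′) → Step.Admissible m<b c L′
  nextSets-admissible {zero}  m<b c = Step.admissible-first m<b c refl
  nextSets-admissible {suc m} m<b c = Step.admissible-next m<b c

  factor : ∀ {m} → m < b → ℕ
  factor {zero}  _   = layerSize G t
  factor {suc m} m<b = prodFin s (λ k → B k ^ indicator (glueSizeIs k (fromℕ< m<b)))

  enough-nextSets : ∀ {m} (m<b : m < b) c → factor m<b ≤ countList (nextSets m<b c) (allSubsets n)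
  enough-nextSets {zero}  m<b c = ℕₚ.≤-refl
  enough-nextSets {suc m} m<b c = Step.enough-candidates m<b c (s≤s z≤n)

  extendBy : ∀ {m} (m<b : m < b) (c : PartialCopy m) → Σ (Subset n) (T ∘ nextSets m<b c) → PartialCopy (suc m)
  extendBy m<b c (L′ , h) = Step.extend m<b c L′ (nextSets-admissible m<b c L′ h)

  L-extendBy : ∀ {m} (m<b : m < b) c a → L (extendBy m<b c a) ≡ L c [ fromℕ< m<b ]≔ proj₁ a
  L-extendBy m<b c a = refl

  children : ∀ {m} → m < b → PartialCopy m → List (PartialCopy (suc m))
  children m<b c = map (extendBy m<b c) (select (nextSets m<b c) (allSubsets n))

  module _ {m} (m<b : m < b) (c : PartialCopy m) where

    enough-children : factor m<b ≤ length (children m<b c)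
    enough-children = ℕₚ.≤-trans (enough-nextSets m<b c) (ℕₚ.≤-reflexive (sym
      (trans (Listₚ.length-map (extendBy m<b c) (select (nextSets m<b c) (allSubsets n)))
             (length-select (nextSets m<b c) (allSubsets n)))))

    distinct-children : Distinct L (children m<b c)
    distinct-children = distinct-map (extendBy m<b c)
      (λ {a} {a′} eq → []≔-injective (L c) (fromℕ< m<b) (proj₁ a) (proj₁ a′)
        (trans (sym (L-extendBy m<b c a)) (trans eq (L-extendBy m<b c a′))))
      (distinct-select (nextSets m<b c) (unique-allSubsets n))

    children-forget : ∀ {c′} → c′ ∈ˡ children m<b c → L c ≡ L c′ [ fromℕ< m<b ]≔ ⊥
    children-forget c′∈ =
      let a , _ , c′≡ = ∈ˡₚ.∈-map⁻ (extendBy m<b c) c′∈ in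
      trans ([]≔-restore (L c) (fromℕ< m<b) (proj₁ a) (IsPartialCopy.unused (isPartialCopy c) (fromℕ< m<b)
              (ℕₚ.≤-reflexive (sym (Finₚ.toℕ-fromℕ< m<b)))))
            (cong (_[ fromℕ< m<b ]≔ ⊥) (sym (trans (cong L c′≡) (L-extendBy m<b c a))))

  weight : ℕ → ℕ
  weight zero    = 1
  weight (suc m) = layerSize G t * prodFin s (λ k → B k ^ countBelow (suc m) b (glueSizeIs k))

  glueSizeIs-first : ∀ k (0<b : 0 < b) → glueSizeIs k (fromℕ< 0<b) ≡ false
  glueSizeIs-first k 0<b rewrite Finₚ.toℕ-fromℕ< 0<b = refl

  weight-suc : ∀ {m} (m<b : m < b) → weight (suc m) ≡ weight m * factor m<b
  weight-suc {zero} 0<b = begin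
    layerSize G t * prodFin s (λ k → B k ^ countBelow 1 b (glueSizeIs k))
      ≡⟨ cong (layerSize G t *_) (prodFin-1 s (λ k → B k ^ countBelow 1 b (glueSizeIs k)) λ k →
           cong (B k ^_) (trans (countBelow-suc b 0 (glueSizeIs k) 0<b)
             (cong₂ _+_ (countBelow-zero b (glueSizeIs k)) (cong indicator (glueSizeIs-first k 0<b))))) ⟩
    layerSize G t * 1
      ≡⟨ ℕₚ.*-comm (layerSize G t) 1 ⟩
    1 * layerSize G t ∎
    where open ≡-Reasoning
  weight-suc {suc m} m<b = trans
    (cong (layerSize G t *_) (prodFin-^-countBelow-suc s b (suc m) B glueSizeIs m<b))
    (sym (ℕₚ.*-assoc (layerSize G t) _ _))

  record Stage (m : ℕ) : Set where
    field
      partials : List (PartialCopy m)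
      distinct : Distinct L partials
      many     : weight m ≤ length partials

  -- v is only a filler for the values of φ at vertices not yet placed.
  initial : Fin n → PartialCopy 0
  initial v = partialCopy (replicate b ⊥) (replicate r v) record
    { members   = λ _ ()
    ; image-K   = λ _ ()
    ; unused    = λ i _ → Vecₚ.lookup-replicate i ⊥
    ; injective = λ { (_ , () , _) }
    }

  stage : Fin n → ∀ m → m ≤ b → Stage m
  stage v zero    _   = record { partials = initial v ∷ [] ; distinct = [] ∷ [] ; many = ℕₚ.≤-refl }
  stage v (suc m) m<b = record
    { partials = concatMap (children m<b) partials
    ; distinct = distinct-concatMap (children m<b) distinct (λ {c} _ → distinct-children m<b c) across
    ; many     = ℕₚ.≤-trans (ℕₚ.≤-reflexive (weight-suc m<b)) (ℕₚ.≤-trans (ℕₚ.*-monoˡ-≤ (factor m<b) many)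
                   (length-concatMap≥ (children m<b) (factor m<b) partials (λ {c} _ → enough-children m<b c)))
    }
    where
    open Stage (stage v m (ℕₚ.<⇒≤ m<b))
    across : ∀ {c c′ d d′} → L c ≢ L c′ → d ∈ˡ children m<b c → d′ ∈ˡ children m<b c′ → L d ≢ L d′
    across {c} {c′} {d} {d′} Lc≢Lc′ d∈ d′∈ Ld≡Ld′ = Lc≢Lc′ (begin
      L c                       ≡⟨ children-forget m<b c d∈ ⟩
      L d [ fromℕ< m<b ]≔ ⊥     ≡⟨ cong (_[ fromℕ< m<b ]≔ ⊥) Ld≡Ld′ ⟩
      L d′ [ fromℕ< m<b ]≔ ⊥    ≡⟨ children-forget m<b c′ d′∈ ⟨
      L c′                      ∎)
      where open ≡-Reasoning

  isCopy : (c : PartialCopy b) → T (isCopyᵇ G K (L c) (φ c))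
  isCopy (partialCopy L φ isPartial) = T-∧⁺ (allFin⁺ b _ sets)
    (T-∧⁺ (allFin⁺ r _ λ x → allFin⁺ r _ (injectivity x)) (fromWitness (⊆-antisym image⊆⋃L ⋃L⊆image)))
    where
    open IsPartialCopy isPartial
    placed : ∀ x → Placed b x
    placed x = let i , x∈K = K-covers x in i , Finₚ.toℕ<n i , x∈K
    sets : ∀ i → T (G (lookup L i) ∧ eqSᵇ (image φ (K i)) (lookup L i))
    sets i = T-∧⁺ (members i (Finₚ.toℕ<n i)) (fromWitness (image-K i (Finₚ.toℕ<n i)))
    injectivity : ∀ x y → T (not (eqFᵇ (lookup φ x) (lookup φ y)) ∨ eqFᵇ x y)
    injectivity x y with lookup φ x F.≟ lookup φ y
    ... | yes φx≡φy = fromWitness (injective (placed x) (placed y) φx≡φy)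
    ... | no  _     = tt
    image⊆⋃L : image φ ⊤ ⊆ bigUnion L
    image⊆⋃L y∈ = let x , _ , φx≡y = ∈-image⁻ φ {⊤} y∈ ; i , i<b , x∈K = placed x in
      ∈-bigUnion⁺ L i (subst (_∈ lookup L i) φx≡y (subst (lookup φ x ∈_) (image-K i i<b) (∈-image⁺ φ {K i} x∈K)))
    ⋃L⊆image : bigUnion L ⊆ image φ ⊤
    ⋃L⊆image y∈ = let i , y∈L = ∈-bigUnion⁻ L y∈
                      x , _ , φx≡y = ∈-image⁻ φ {K i} (subst (_ ∈_) (sym (image-K i (Finₚ.toℕ<n i))) y∈L) in
      subst (_∈ image φ ⊤) φx≡y (∈-image⁺ φ {⊤} ∈⊤)

  weight≤copies : Fin n → weight b ≤ copies G K
  weight≤copies v = ℕₚ.≤-trans many (ℕₚ.≤-trans (ℕₚ.≤-reflexive (sym (Listₚ.length-map table partials)))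
    (unique⇒length≤countList _ (distinct-map table (cong proj₁) distinct)
      λ x∈ → let c , _ , x≡ = ∈ˡₚ.∈-map⁻ table x∈ in
        subst (λ x → x ∈ˡ _ × T (isCopyᵇ G K (proj₁ x) (proj₂ x))) (sym x≡)
          (∈-copyCandidates (L c) (φ c) , isCopy c)))
    where
    open Stage (stage v b ℕₚ.≤-refl)
    table : PartialCopy b → Vec (Subset n) b × Vec (Fin n) r
    table c = L c , φ c

  weight-closed : ∀ m → 1 ≤ m → weight m ≡ layerSize G t * prodFin s (λ k → B k ^ countBelow m b (glueSizeIs k))
  weight-closed (suc m) _ = refl

  lower-bound : 1 ≤ b → Fin n → layerSize G t * prodFin s (λ k → B k ^ dcount K j (suc (toℕ k))) ≤ copies G K
  lower-bound 1≤b v = ℕₚ.≤-trans (ℕₚ.≤-reflexive (begin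
    layerSize G t * prodFin s (λ k → B k ^ countFin b (glueSizeIs k))
      ≡⟨ cong (layerSize G t *_) (prodFin-cong s λ k → cong (B k ^_) (countBelow-all b (glueSizeIs k))) ⟨
    layerSize G t * prodFin s (λ k → B k ^ countBelow b b (glueSizeIs k))
      ≡⟨ weight-closed b 1≤b ⟨
    weight b ∎)) (weight≤copies v)
    where open ≡-Reasoning

lemma3p8 : (t s ℓ r b : ℕ) → s < t → 1 ≤ ℓ → (B : Fin s → ℕ)
    → (E : Fin r → Fin r → Set) → IsSimpleGraph E
    → (K : Fin b → Subset r) (j : Fin b → Fin b)
    → IsWitness t E b K j → GlueAtMost K j s
    → (n : ℕ) (G : Subset n → Bool)
    → IsTComplex t G → IsStrongBuilder t s ℓ r B G
    → layerSize G t * prodFin s (λ k → B k ^ dcount K j (suc (toℕ k))) ≤ copies G K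
lemma3p8 _ _ _ _ _ _ _ _ _ _ K _ _ _ zero G complex _ =
  subst (λ size → size * _ ≤ copies G K) (sym (layerSize-Fin0≡0 G complex)) z≤n
lemma3p8 _ _ _ _ _ _ _ B _ _ K j (1≤b , K-size , _ , K-covers , K-steps) glue≤s (suc n) G complex builder =
  Construction.lower-bound B K j K-size K-covers K-glued glue≤s G complex builder 1≤b F.zero
  where
  K-glued : ∀ i → 1 ≤ toℕ i → toℕ (j i) < toℕ i × K i ∩ prefixUnion K i ≡ glue K j i × Nonempty (glue K j i)
  K-glued i 1≤i = let j<i , glued , nonempty , _ = K-steps i 1≤i in j<i , glued , nonempty
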